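{- Let $G$ be a graph with spanning tree $T$, and suppose there is an acyclic charging scheme of value $v$ from $G$ to $T$. Then for any edge $e$ of $G-T$, there is an acyclic charging scheme of value $v$ from $G-e$ to $T$.
   Context: A detour in a graph $G$ is a pair $(e,P)$ of an edge $e$ and a path $P$ such that $e+P$ is a simple cycle in $G$. A charging scheme assigns a value $x_{(e,P)}\ge 0$ to each detour; the move $x_{(e,P)}$ subtracts $x_{(e,P)}$ units of charge from $e$ and adds $x_{(e,P)}$ units to each edge of $P$ ("$e$ charges $P$" when $x_{(e,P)}>0$). Let $\mathrm{Out}(e)=\sum_P x_{(e,P)}$, $\mathrm{In}(e)=\sum_{(e',P):\, e\in P} x_{(e',P)}$, and $\mathrm{Net}(e)=\mathrm{In}(e)-\mathrm{Out}(e)$. Given a spanning tree $T$ of $G$ and a number $v$, a charging scheme from $G$ to $T$ of value $v$ is such an assignment with (1) $\mathrm{Out}(e)\ge 1$ for all $e\in G-T$; (2) $\mathrm{Net}(e)\le 0$ for all $e\in G-T$; (3) $\mathrm{Net}(e)\le v$ for all $e\in T$. It is acyclic if additionally (4) every edge that charges some path lies in $G-T$, and (5) there is an ordering of the edges such that whenever $e_1$ charges a path containing $e_2$, $e_1$ precedes $e_2$.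
   Formalization: The charges $x_{(e,P)}$ and the value $v$ are rational numbers. -}

module Defs where

open import Data.Nat as ℕ using (ℕ)
open import Data.Fin using (Fin; _≟_)
open import Data.Bool using (if_then_else_)
open import Data.List using (List; []; _∷_; map; foldr; concatMap)
open import Data.List.Relation.Unary.All using (All)
open import Data.List.Relation.Unary.Any using (Any)
open import Data.List.Relation.Unary.Unique.Propositional using (Unique)
open import Data.Product using (Σ; ∃; _×_; _,_; proj₁; proj₂)
open import Data.Sum using (_⊎_)
open import Data.Rational as ℚ using (ℚ; 0ℚ; 1ℚ)
open import Relation.Binary.PropositionalEquality using (_≡_; _≢_)
open import Relation.Nullary using (¬_; Dec; yes; no)
open import Relation.Nullary.Decidable using (⌊_⌋; _×-dec_; _⊎-dec_)

record Graph (n : ℕ) : Set₁ where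
  field
    Adj    : Fin n → Fin n → Set
    sym    : ∀ {u v} → Adj u v → Adj v u
    irrefl : ∀ {u} → ¬ Adj u u
open Graph public

-- An edge is named by its two endpoints (as an ordered pair; an edge {u,v}
-- is identified with both (u,v) and (v,u) via SameEdge).
Edge : ℕ → Set
Edge n = Fin n × Fin n

SameEdge : ∀ {n} → Edge n → Edge n → Set
SameEdge (a , b) (c , d) = (a ≡ c × b ≡ d) ⊎ (a ≡ d × b ≡ c)

sameEdge? : ∀ {n} (e f : Edge n) → Dec (SameEdge e f)
sameEdge? (a , b) (c , d) = ((a ≟ c) ×-dec (b ≟ d)) ⊎-dec ((a ≟ d) ×-dec (b ≟ c))

deleteEdge : ∀ {n} → Graph n → Edge n → Graph n
deleteEdge G e = record
  { Adj    = λ u v → Adj G u v × ¬ SameEdge (u , v) e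
  ; sym    = λ { (a , ne) → sym G a , λ s → ne (flip s) }
  ; irrefl = λ { (a , _) → irrefl G a }
  }
  where
  flip : ∀ {u v} → SameEdge (v , u) e → SameEdge (u , v) e
  flip {u} {v} (Data.Sum.inj₁ (p , q)) = Data.Sum.inj₂ (q , p)
  flip {u} {v} (Data.Sum.inj₂ (p , q)) = Data.Sum.inj₁ (q , p)

data Walk {n : ℕ} (A : Fin n → Fin n → Set) : Fin n → Fin n → Set where
  []  : ∀ {u} → Walk A u u
  _∷_ : ∀ {u v w} → A u v → Walk A v w → Walk A u w

vertices : ∀ {n} {A : Fin n → Fin n → Set} {u v} → Walk A u v → List (Fin n)
vertices {u = u} []           = u ∷ []
vertices {u = u} (_ ∷ w)      = u ∷ vertices w

edges : ∀ {n} {A : Fin n → Fin n → Set} {u v} → Walk A u v → List (Edge n)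
edges []                      = []
edges {u = u} (_∷_ {v = v} _ w) = (u , v) ∷ edges w

IsPath : ∀ {n} {A : Fin n → Fin n → Set} {u v} → Walk A u v → Set
IsPath w = Unique (vertices w)

-- (e , P) with e = uv and P a walk from v to u is a detour iff e + P is a
-- simple cycle: P is a path and e is not itself an edge of P.
IsDetour : ∀ {n} {A : Fin n → Fin n → Set} (u v : Fin n) → Walk A v u → Set
IsDetour u v P = IsPath P × ¬ Any (SameEdge (u , v)) (edges P)

IsSpanningTree : ∀ {n} → Graph n → Graph n → Set
IsSpanningTree {n} G T =
  (∀ u v → Adj T u v → Adj G u v) ×
  (∀ u v → Walk (Adj T) u v) ×
  (∀ u v → Adj T u v → (P : Walk (Adj T) v u) → ¬ IsDetour u v P)

record Detour {n : ℕ} (G : Graph n) : Set where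
  constructor detour
  field
    u v      : Fin n
    adj      : Adj G u v
    path     : Walk (Adj G) v u
    isDetour : IsDetour u v path
open Detour public

dEdge : ∀ {n} {G : Graph n} → Detour G → Edge n
dEdge d = (u d , v d)

-- A charging scheme, given by its (finite) support: a list of detours with
-- their values x_(e,P).  (Repeated detours simply add up.)
Scheme : ∀ {n} → Graph n → Set
Scheme G = List (Detour G × ℚ)

sumℚ : List ℚ → ℚ
sumℚ = foldr ℚ._+_ 0ℚ

indicator : ∀ {n} → Edge n → Edge n → ℚ → ℚ
indicator f e x = if ⌊ sameEdge? f e ⌋ then x else 0ℚ

Out : ∀ {n} {G : Graph n} → Scheme G → Edge n → ℚ
Out S e = sumℚ (map (λ dx → indicator (dEdge (proj₁ dx)) e (proj₂ dx)) S)

In : ∀ {n} {G : Graph n} → Scheme G → Edge n → ℚ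
In S e = sumℚ (map (λ dx → sumℚ (map (λ f → indicator f e (proj₂ dx))
                                      (edges (path (proj₁ dx))))) S)

Net : ∀ {n} {G : Graph n} → Scheme G → Edge n → ℚ
Net S e = In S e ℚ.- Out S e

IsChargingScheme : ∀ {n} (G T : Graph n) → ℚ → Scheme G → Set
IsChargingScheme G T val S =
  All (λ dx → 0ℚ ℚ.≤ proj₂ dx) S ×
  (∀ a b → Adj G a b → ¬ Adj T a b → 1ℚ ℚ.≤ Out S (a , b)) ×
  (∀ a b → Adj G a b → ¬ Adj T a b → Net S (a , b) ℚ.≤ 0ℚ) ×
  (∀ a b → Adj T a b → Net S (a , b) ℚ.≤ val)

-- An ordering of the edges of G, given by ranks: well defined on edges,
-- injective on distinct edges of G (so it is a linear order of E(G)).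
IsEdgeOrdering : ∀ {n} → Graph n → (Fin n → Fin n → ℕ) → Set
IsEdgeOrdering G rank =
  (∀ a b → rank a b ≡ rank b a) ×
  (∀ a b c d → Adj G a b → Adj G c d → ¬ SameEdge (a , b) (c , d) →
     rank a b ≢ rank c d)

IsAcyclicChargingScheme : ∀ {n} (G T : Graph n) → ℚ → Scheme G → Set
IsAcyclicChargingScheme G T val S =
  IsChargingScheme G T val S ×
  All (λ dx → ℚ.0ℚ ℚ.< proj₂ dx → ¬ Adj T (u (proj₁ dx)) (v (proj₁ dx))) S ×
  ∃ (λ rank → IsEdgeOrdering G rank ×
     All (λ dx → ℚ.0ℚ ℚ.< proj₂ dx →
            All (λ f → rank (u (proj₁ dx)) (v (proj₁ dx)) ℕ.< rank (proj₁ f) (proj₂ f))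
                (edges (path (proj₁ dx)))) S)

HasAcyclicChargingScheme : ∀ {n} (G T : Graph n) → ℚ → Set
HasAcyclicChargingScheme G T val = Σ (Scheme G) (IsAcyclicChargingScheme G T val)

-- T does not contain e, so it is still a spanning tree of
-- G - e.  To get rid of e we reroute.  Let O = Out(e) ≥ 1 and let (e , Q_q),
-- with weights w_q > 0, be the detours charged by e, so that Σ w_q = O.
-- Every other detour (d , P) of weight x > 0 is replaced by the detours
-- (d , R_q) of weights x · w_q / O, where R_q is the loop erasure of the walk
-- obtained from P by replacing each traversal of e by Q_q; the detours of e
-- are dropped.  Away from e, Out is unchanged, and an edge g receives at most
-- In(g) - O·K(g) + In(e)·K(g) ≤ In(g), where O·K(g) is the charge e sent to g
-- and In(e) ≤ O by condition (2).  Acyclicity makes R_q a detour of d: since d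
-- charges e and e charges Q_q, d precedes every edge of R_q, so d ∉ R_q; for
-- the same reason the old ordering is still valid for the new scheme.

module Submission where

open import Defs hiding (sym)
open import Data.Nat as ℕ using (ℕ)
import Data.Nat.Properties as ℕP
open import Data.Fin using (Fin; _≟_)
open import Data.Product using (Σ; _×_; _,_; proj₁; proj₂)
open import Data.Sum using (_⊎_; inj₁; inj₂)
open import Data.Rational as ℚ using (ℚ; 0ℚ; 1ℚ; _+_; _*_; _≤_; _<_)
import Data.Rational.Properties as ℚP
open import Data.Rational.Solver using (module +-*-Solver)
open import Data.List using (List; []; _∷_; _++_; map; concatMap)
open import Data.List.Properties using (map-cong; map-cong-local; map-∘)
open import Data.List.Relation.Unary.All as All using (All; []; _∷_)
import Data.List.Relation.Unary.All.Properties as AllP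
open import Data.List.Relation.Unary.AllPairs using ([]; _∷_)
open import Data.List.Relation.Unary.Any as Any using (Any; here; there)
open import Data.List.Relation.Binary.Sublist.Propositional using (_⊆_; []; _∷_; _∷ʳ_; ⊆-refl; ⊆-trans)
import Data.List.Relation.Binary.Sublist.Propositional.Properties as SubP
open import Relation.Binary.PropositionalEquality
open import Relation.Nullary using (¬_; Dec; yes; no)
open import Function using (_∘_)
open import Data.Empty using (⊥-elim)

open +-*-Solver

module _ {n : ℕ} where

  sameEdge-refl : ∀ {f : Edge n} → SameEdge f f
  sameEdge-refl = inj₁ (refl , refl)

  sameEdge-flip : ∀ {x y : Fin n} → SameEdge (x , y) (y , x)
  sameEdge-flip = inj₂ (refl , refl)

  sameEdge-sym : ∀ {f g : Edge n} → SameEdge f g → SameEdge g f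
  sameEdge-sym (inj₁ (refl , refl)) = sameEdge-refl
  sameEdge-sym (inj₂ (refl , refl)) = sameEdge-flip

  sameEdge-trans : ∀ {f g h : Edge n} → SameEdge f g → SameEdge g h → SameEdge f h
  sameEdge-trans (inj₁ (refl , refl)) s = s
  sameEdge-trans (inj₂ (refl , refl)) (inj₁ (refl , refl)) = sameEdge-flip
  sameEdge-trans (inj₂ (refl , refl)) (inj₂ (refl , refl)) = sameEdge-refl

  Unoriented : ∀ {ℓ} → (Edge n → Set ℓ) → Set ℓ
  Unoriented P = ∀ x y → P (x , y) → P (y , x)

  unoriented-resp : ∀ {ℓ} {P : Edge n → Set ℓ} → Unoriented P →
                    ∀ {f g} → SameEdge f g → P f → P g
  unoriented-resp P-flip (inj₁ (refl , refl)) p = p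
  unoriented-resp P-flip (inj₂ (refl , refl)) p = P-flip _ _ p

module _ {n : ℕ} where

  indicator-same : ∀ {f g : Edge n} c → SameEdge f g → indicator f g c ≡ c
  indicator-same {f} {g} c s with sameEdge? f g
  ... | yes _ = refl
  ... | no ¬s = ⊥-elim (¬s s)

  indicator-apart : ∀ {f g : Edge n} c → ¬ SameEdge f g → indicator f g c ≡ 0ℚ
  indicator-apart {f} {g} c ¬s with sameEdge? f g
  ... | yes s = ⊥-elim (¬s s)
  ... | no _  = refl

  indicator-scale : ∀ (f g : Edge n) c → indicator f g c ≡ c * indicator f g 1ℚ
  indicator-scale f g c with sameEdge? f g
  ... | yes _ = sym (ℚP.*-identityʳ c)
  ... | no _  = sym (ℚP.*-zeroʳ c)

  indicator-zero : ∀ (f g : Edge n) → indicator f g 0ℚ ≡ 0ℚ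
  indicator-zero f g with sameEdge? f g
  ... | yes _ = refl
  ... | no _  = refl

  indicator-nonneg : ∀ (f g : Edge n) {c} → 0ℚ ≤ c → 0ℚ ≤ indicator f g c
  indicator-nonneg f g c≥0 with sameEdge? f g
  ... | yes _ = c≥0
  ... | no _  = ℚP.≤-refl

  indicator-flip : ∀ (x y : Fin n) g c → indicator (x , y) g c ≡ indicator (y , x) g c
  indicator-flip x y g c with sameEdge? (x , y) g | sameEdge? (y , x) g
  ... | yes _ | yes _ = refl
  ... | no _  | no _  = refl
  ... | yes s | no ¬s = ⊥-elim (¬s (sameEdge-trans sameEdge-flip s))
  ... | no ¬s | yes s = ⊥-elim (¬s (sameEdge-trans sameEdge-flip s))

module _ {A : Set} where

  sum-++ : ∀ (f : A → ℚ) xs ys →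
           sumℚ (map f (xs ++ ys)) ≡ sumℚ (map f xs) + sumℚ (map f ys)
  sum-++ f []       ys = sym (ℚP.+-identityˡ _)
  sum-++ f (x ∷ xs) ys = trans (cong (f x +_) (sum-++ f xs ys)) (sym (ℚP.+-assoc (f x) _ _))

  sum-+ : ∀ (f g : A → ℚ) xs →
          sumℚ (map (λ x → f x + g x) xs) ≡ sumℚ (map f xs) + sumℚ (map g xs)
  sum-+ f g []       = refl
  sum-+ f g (x ∷ xs) rewrite sum-+ f g xs =
    solve 4 (λ a b c d → (a :+ b) :+ (c :+ d) := (a :+ c) :+ (b :+ d)) refl
      (f x) (g x) (sumℚ (map f xs)) (sumℚ (map g xs))

  sum-scaleˡ : ∀ c (f : A → ℚ) xs → sumℚ (map (λ x → c * f x) xs) ≡ c * sumℚ (map f xs)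
  sum-scaleˡ c f []       = sym (ℚP.*-zeroʳ c)
  sum-scaleˡ c f (x ∷ xs) rewrite sum-scaleˡ c f xs = sym (ℚP.*-distribˡ-+ c (f x) _)

  sum-scaleʳ : ∀ c (f : A → ℚ) xs → sumℚ (map (λ x → f x * c) xs) ≡ sumℚ (map f xs) * c
  sum-scaleʳ c f xs = begin
    sumℚ (map (λ x → f x * c) xs)  ≡⟨ cong sumℚ (map-cong (λ x → ℚP.*-comm (f x) c) xs) ⟩
    sumℚ (map (λ x → c * f x) xs)  ≡⟨ sum-scaleˡ c f xs ⟩
    c * sumℚ (map f xs)            ≡⟨ ℚP.*-comm c _ ⟩
    sumℚ (map f xs) * c            ∎
    where open ≡-Reasoning

  sum-mono : ∀ {f g : A → ℚ} {xs} → All (λ x → f x ≤ g x) xs →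
             sumℚ (map f xs) ≤ sumℚ (map g xs)
  sum-mono []       = ℚP.≤-refl
  sum-mono (h ∷ hs) = ℚP.+-mono-≤ h (sum-mono hs)

  sum-nonneg : ∀ {f : A → ℚ} {xs} → All (λ x → 0ℚ ≤ f x) xs → 0ℚ ≤ sumℚ (map f xs)
  sum-nonneg []       = ℚP.≤-refl
  sum-nonneg (h ∷ hs) = ℚP.+-mono-≤ h (sum-nonneg hs)

  sum-⊆ : ∀ {f : A → ℚ} → (∀ x → 0ℚ ≤ f x) → ∀ {xs ys} → xs ⊆ ys →
          sumℚ (map f xs) ≤ sumℚ (map f ys)
  sum-⊆ f≥0 []           = ℚP.≤-refl
  sum-⊆ {f} f≥0 {xs} (y ∷ʳ xs⊆ys) =
    subst (_≤ _) (ℚP.+-identityˡ (sumℚ (map f xs))) (ℚP.+-mono-≤ (f≥0 y) (sum-⊆ f≥0 xs⊆ys))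
  sum-⊆ {f} f≥0 (_∷_ {x} refl xs⊆ys) = ℚP.+-mono-≤ (ℚP.≤-refl {f x}) (sum-⊆ f≥0 xs⊆ys)

sum-map : ∀ {A B : Set} (f : B → ℚ) (h : A → B) xs →
          sumℚ (map f (map h xs)) ≡ sumℚ (map (λ x → f (h x)) xs)
sum-map f h xs = cong sumℚ (sym (map-∘ xs))

sum-concatMap : ∀ {A B : Set} (f : B → ℚ) (g : A → List B) xs →
                sumℚ (map f (concatMap g xs)) ≡ sumℚ (map (λ x → sumℚ (map f (g x))) xs)
sum-concatMap f g []       = refl
sum-concatMap f g (x ∷ xs) = trans (sum-++ f (g x) (concatMap g xs)) (cong (sumℚ (map f (g x)) +_) (sum-concatMap f g xs))

mult : ∀ {n} → List (Edge n) → Edge n → ℚ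
mult L g = sumℚ (map (λ f → indicator f g 1ℚ) L)

module _ {n : ℕ} where

  charge-mult : ∀ (L : List (Edge n)) g c →
                sumℚ (map (λ f → indicator f g c) L) ≡ c * mult L g
  charge-mult L g c =
    trans (cong sumℚ (map-cong (λ f → indicator-scale f g c) L)) (sum-scaleˡ c _ L)

  mult-nonneg : ∀ (L : List (Edge n)) g → 0ℚ ≤ mult L g
  mult-nonneg L g = sum-nonneg (All.universal (λ f → indicator-nonneg f g (ℚP.nonNegative⁻¹ 1ℚ)) L)

  mult-⊆ : ∀ {L M : List (Edge n)} g → L ⊆ M → mult L g ≤ mult M g
  mult-⊆ g = sum-⊆ (λ f → indicator-nonneg f g (ℚP.nonNegative⁻¹ 1ℚ))

  mult-++ : ∀ (L M : List (Edge n)) g → mult (L ++ M) g ≡ mult L g + mult M g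
  mult-++ L M g = sum-++ _ L M

module _ {n : ℕ} {A : Fin n → Fin n → Set} where

  infixr 5 _++ʷ_
  _++ʷ_ : ∀ {s t r} → Walk A s t → Walk A t r → Walk A s r
  []      ++ʷ w₂ = w₂
  (x ∷ w₁) ++ʷ w₂ = x ∷ (w₁ ++ʷ w₂)

  edges-++ : ∀ {s t r} (w₁ : Walk A s t) (w₂ : Walk A t r) →
             edges (w₁ ++ʷ w₂) ≡ edges w₁ ++ edges w₂
  edges-++ []       w₂ = refl
  edges-++ (x ∷ w₁) w₂ = cong (_ ∷_) (edges-++ w₁ w₂)

  module _ (A-sym : ∀ {x y} → A x y → A y x) where

    reverse : ∀ {s t} → Walk A s t → Walk A t s
    reverse []      = []
    reverse (x ∷ w) = reverse w ++ʷ (A-sym x ∷ [])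

    -- Reversal only changes the orientation of the edges of a walk, so it
    -- preserves sums and properties that ignore orientation.
    sum-reverse : (h : Edge n → ℚ) → (∀ x y → h (x , y) ≡ h (y , x)) →
                  ∀ {s t} (w : Walk A s t) → sumℚ (map h (edges (reverse w))) ≡ sumℚ (map h (edges w))
    sum-reverse h h-flip [] = refl
    sum-reverse h h-flip (_∷_ {s} {t} x w) =
      begin
        sumℚ (map h (edges (reverse w ++ʷ (A-sym x ∷ []))))
      ≡⟨ cong (λ l → sumℚ (map h l)) (edges-++ (reverse w) (A-sym x ∷ [])) ⟩
        sumℚ (map h (edges (reverse w) ++ (t , s) ∷ []))
      ≡⟨ sum-++ h (edges (reverse w)) ((t , s) ∷ []) ⟩
        sumℚ (map h (edges (reverse w))) + (h (t , s) + 0ℚ)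
      ≡⟨ cong₂ (λ p q → p + (q + 0ℚ)) (sum-reverse h h-flip w) (h-flip t s) ⟩
        sumℚ (map h (edges w)) + (h (s , t) + 0ℚ)
      ≡⟨ solve 2 (λ p q → p :+ (q :+ con 0ℚ) := q :+ p) refl (sumℚ (map h (edges w))) (h (s , t)) ⟩
        h (s , t) + sumℚ (map h (edges w))
      ∎
      where open ≡-Reasoning

    All-reverse : ∀ {P : Edge n → Set} → Unoriented P →
                  ∀ {s t} (w : Walk A s t) → All P (edges w) → All P (edges (reverse w))
    All-reverse P-flip [] [] = []
    All-reverse P-flip (_∷_ {s} {t} x w) (p ∷ ps) =
      subst (All _) (sym (edges-++ (reverse w) (A-sym x ∷ [])))
        (AllP.++⁺ (All-reverse P-flip w ps) (P-flip s t p ∷ []))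

    reorient : ∀ {x y x′ y′} → SameEdge (x , y) (x′ , y′) → Walk A y x → Walk A y′ x′
    reorient (inj₁ (refl , refl)) w = w
    reorient (inj₂ (refl , refl)) w = reverse w

    sum-reorient : (h : Edge n → ℚ) → (∀ x y → h (x , y) ≡ h (y , x)) →
                   ∀ {x y x′ y′} (s : SameEdge (x , y) (x′ , y′)) (w : Walk A y x) →
                   sumℚ (map h (edges (reorient s w))) ≡ sumℚ (map h (edges w))
    sum-reorient h h-flip (inj₁ (refl , refl)) w = refl
    sum-reorient h h-flip (inj₂ (refl , refl)) w = sum-reverse h h-flip w

    All-reorient : ∀ {P : Edge n → Set} → Unoriented P →
                   ∀ {x y x′ y′} (s : SameEdge (x , y) (x′ , y′)) (w : Walk A y x) →
                   All P (edges w) → All P (edges (reorient s w))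
    All-reorient P-flip (inj₁ (refl , refl)) w ps = ps
    All-reorient P-flip (inj₂ (refl , refl)) w ps = All-reverse P-flip w ps

  suffixFrom : ∀ {s t} (R : Walk A s t) → IsPath R → (x : Fin n) →
               Σ (Walk A x t) (λ R′ → IsPath R′ × edges R′ ⊆ edges R)
               ⊎ All (x ≢_) (vertices R)
  suffixFrom {s} [] R-path x with x ≟ s
  ... | yes refl = inj₁ ([] , R-path , [])
  ... | no x≢s   = inj₂ (x≢s ∷ [])
  suffixFrom {s} (st ∷ R) R-path x with x ≟ s
  ... | yes refl = inj₁ (st ∷ R , R-path , ⊆-refl)
  suffixFrom {s} (st ∷ R) (_ ∷ R-path) x | no x≢s with suffixFrom R R-path x
  ... | inj₁ (R′ , R′-path , R′⊆R) = inj₁ (R′ , R′-path , _ ∷ʳ R′⊆R)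
  ... | inj₂ x∉R                   = inj₂ (x≢s ∷ x∉R)

  loopErase : ∀ {s t} (w : Walk A s t) → Σ (Walk A s t) (λ R → IsPath R × edges R ⊆ edges w)
  loopErase []  = [] , [] ∷ [] , []
  loopErase {s} (st ∷ w) with loopErase w
  ... | R , R-path , R⊆w with suffixFrom R R-path s
  ...   | inj₁ (R′ , R′-path , R′⊆R) = R′ , R′-path , _ ∷ʳ ⊆-trans R′⊆R R⊆w
  ...   | inj₂ s∉R                   = st ∷ R , s∉R ∷ R-path , refl ∷ R⊆w

*-nonneg : ∀ {p q} → 0ℚ ≤ p → 0ℚ ≤ q → 0ℚ ≤ p * q
*-nonneg {p} {q} p≥0 q≥0 = ℚP.nonNegative⁻¹ (p * q)
  {{ℚP.nonNeg*nonNeg⇒nonNeg p {{ℚ.nonNegative p≥0}} q {{ℚ.nonNegative q≥0}}}}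

*-monoʳ-nonneg : ∀ {r p q} → 0ℚ ≤ r → p ≤ q → r * p ≤ r * q
*-monoʳ-nonneg {r} r≥0 = ℚP.*-monoˡ-≤-nonNeg r {{ℚ.nonNegative r≥0}}

+-cancelʳ-≤ : ∀ {p q} c → p + c ≤ q + c → p ≤ q
+-cancelʳ-≤ {p} {q} c p+c≤q+c =
  subst₂ _≤_ (solve 2 (λ x c → (x :+ c) :- c := x) refl p c)
             (solve 2 (λ x c → (x :+ c) :- c := x) refl q c)
             (ℚP.+-monoˡ-≤ (ℚ.- c) p+c≤q+c)

nonpos-diff : ∀ {p q} → p ℚ.- q ≤ 0ℚ → p ≤ q
nonpos-diff {p} {q} p-q≤0 =
  subst₂ _≤_ (solve 2 (λ p q → (p :- q) :+ q := p) refl p q) (ℚP.+-identityˡ q)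
             (ℚP.+-monoˡ-≤ q p-q≤0)

module Rerouting {n : ℕ} (G : Graph n) (a b : Fin n)
                 (rank : Fin n → Fin n → ℕ) (rank-sym : ∀ x y → rank x y ≡ rank y x) where

  e : Edge n
  e = a , b

  G-e : Graph n
  G-e = deleteEdge G e

  rk : Edge n → ℕ
  rk f = rank (proj₁ f) (proj₂ f)

  rk-resp : ∀ {f g} → SameEdge f g → rk f ≡ rk g
  rk-resp (inj₁ (refl , refl)) = refl
  rk-resp (inj₂ (refl , refl)) = rank-sym _ _

  Above : ℕ → Edge n → Set
  Above r f = r ℕ.< rk f

  above-unoriented : ∀ r → Unoriented (Above r)
  above-unoriented r x y = subst (r ℕ.<_) (rank-sym x y)

  above-∉ : ∀ {f L} → All (Above (rk f)) L → ¬ Any (SameEdge f) L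
  above-∉ (f<g ∷ _)   (here s)   = ℕP.<-irrefl (rk-resp s) f<g
  above-∉ (_ ∷ f<gs) (there f∈L) = above-∉ f<gs f∈L

  Ranked : ∀ {H : Graph n} → Detour H → Set
  Ranked d = All (Above (rk (dEdge d))) (edges (path d))

  ranked? : ∀ {H : Graph n} (d : Detour H) → Dec (Ranked d)
  ranked? d = All.all? (λ f → rk (dEdge d) ℕ.<? rk f) (edges (path d))

  avoid : ∀ {s t} (w : Walk (Adj G) s t) → ¬ Any (λ f → SameEdge f e) (edges w) → Walk (Adj G-e) s t
  avoid []       _     = []
  avoid (xy ∷ w) w∌e = (xy , w∌e ∘ here) ∷ avoid w (w∌e ∘ there)

  edges-avoid : ∀ {s t} (w : Walk (Adj G) s t) w∌e → edges (avoid w w∌e) ≡ edges w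
  edges-avoid []       _   = refl
  edges-avoid (xy ∷ w) w∌e = cong (_ ∷_) (edges-avoid w (w∌e ∘ there))

  -- If the edge xy is e, then ab is the edge yx: a walk from b to a,
  -- re-oriented along this, runs from x to y.
  reversed : ∀ {x y} → SameEdge (x , y) e → SameEdge (a , b) (y , x)
  reversed s = sameEdge-trans (sameEdge-sym s) sameEdge-flip

  module _ (Q : Walk (Adj G-e) b a) where

    bridge : ∀ {x y} → SameEdge (x , y) e → Walk (Adj G-e) x y
    bridge s = reorient (Graph.sym G-e) (reversed s) Q

    splice : ∀ {s t} → Walk (Adj G) s t → Walk (Adj G-e) s t
    splice []                 = []
    splice (_∷_ {x} {y} xy w) with sameEdge? (x , y) e
    ... | yes s  = bridge s ++ʷ splice w
    ... | no ¬s  = (xy , ¬s) ∷ splice w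

    mult-bridge : ∀ {x y} (s : SameEdge (x , y) e) g → mult (edges (bridge s)) g ≡ mult (edges Q) g
    mult-bridge s g = sum-reorient (Graph.sym G-e) (λ f → indicator f g 1ℚ)
                        (λ x y → indicator-flip x y g 1ℚ) (reversed s) Q

    -- Each traversal of e is traded for one copy of Q.
    mult-splice : ∀ g → ¬ SameEdge g e → ∀ {s t} (w : Walk (Adj G) s t) →
                  mult (edges (splice w)) g ≤ mult (edges w) g + mult (edges w) e * mult (edges Q) g
    mult-splice g g≉e [] = ℚP.≤-reflexive (solve 1 (λ q → con 0ℚ := con 0ℚ :+ con 0ℚ :* q) refl (mult (edges Q) g))
    mult-splice g g≉e (_∷_ {x} {y} xy w) with sameEdge? (x , y) e
    ... | yes s = begin
          mult (edges (bridge s ++ʷ splice w)) g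
        ≡⟨ trans (cong (λ l → mult l g) (edges-++ (bridge s) (splice w))) (mult-++ (edges (bridge s)) (edges (splice w)) g) ⟩
          mult (edges (bridge s)) g + mult (edges (splice w)) g
        ≤⟨ ℚP.+-mono-≤ (ℚP.≤-reflexive (mult-bridge s g)) (mult-splice g g≉e w) ⟩
          mQ + (mw g + mw e * mQ)
        ≡⟨ solve 3 (λ q p r → q :+ (p :+ r :* q) := (con 0ℚ :+ p) :+ (con 1ℚ :+ r) :* q) refl mQ (mw g) (mw e) ⟩
          (0ℚ + mw g) + (1ℚ + mw e) * mQ
        ≡⟨ cong (λ i → (i + mw g) + (1ℚ + mw e) * mQ) (sym (indicator-apart 1ℚ g≉xy)) ⟩
          (indicator (x , y) g 1ℚ + mw g) + (1ℚ + mw e) * mQ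
        ∎
      where
        open ℚP.≤-Reasoning
        mQ : ℚ
        mQ = mult (edges Q) g
        mw : Edge n → ℚ
        mw = mult (edges w)
        g≉xy : ¬ SameEdge (x , y) g
        g≉xy xy≈g = g≉e (sameEdge-trans (sameEdge-sym xy≈g) s)
    ... | no ¬s = begin
          indicator (x , y) g 1ℚ + mult (edges (splice w)) g
        ≤⟨ ℚP.+-monoʳ-≤ (indicator (x , y) g 1ℚ) (mult-splice g g≉e w) ⟩
          i + (mw g + mw e * mQ)
        ≡⟨ solve 4 (λ i p r q → i :+ (p :+ r :* q) := (i :+ p) :+ (con 0ℚ :+ r) :* q) refl i (mw g) (mw e) mQ ⟩
          (i + mw g) + (0ℚ + mw e) * mQ
        ∎
      where
        open ℚP.≤-Reasoning
        i : ℚ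
        i = indicator (x , y) g 1ℚ
        mQ : ℚ
        mQ = mult (edges Q) g
        mw : Edge n → ℚ
        mw = mult (edges w)

    All-splice : ∀ {P : Edge n → Set} → Unoriented P → (P e → All P (edges Q)) →
                 ∀ {s t} (w : Walk (Adj G) s t) → All P (edges w) → All P (edges (splice w))
    All-splice P-flip PQ [] [] = []
    All-splice P-flip PQ (_∷_ {x} {y} xy w) (p ∷ ps) with sameEdge? (x , y) e
    ... | yes s = subst (All _) (sym (edges-++ (bridge s) (splice w)))
                    (AllP.++⁺ (All-reorient (Graph.sym G-e) P-flip (reversed s) Q (PQ (unoriented-resp P-flip s p)))
                              (All-splice P-flip PQ w ps))
    ... | no _  = p ∷ All-splice P-flip PQ w ps

  -- A detour of e carrying positive charge; these are the detours deleted
  -- together with e, and their paths are the routes for the rerouting.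
  record Supply : Set where
    field
      src        : Detour G
      weight     : ℚ
      src≈e      : SameEdge (dEdge src) e
      weight>0   : 0ℚ < weight
      src-ranked : Ranked src
  open Supply public

  usage : Supply → Edge n → ℚ
  usage q g = mult (edges (path (src q))) g

  -- The path of a supply avoids e (it is a detour of e), so it is a walk
  -- in G - e; oriented from b to a it is the route of the supply.
  route : Supply → Walk (Adj G-e) b a
  route q = reorient (Graph.sym G-e) (src≈e q) (avoid (path (src q)) path∌e)
    where
      path∌e : ¬ Any (λ f → SameEdge f e) (edges (path (src q)))
      path∌e = proj₂ (isDetour (src q)) ∘ Any.map (λ f≈e → sameEdge-trans (src≈e q) (sameEdge-sym f≈e))

  mult-route : ∀ q g → mult (edges (route q)) g ≡ usage q g
  mult-route q g =
    trans (sum-reorient (Graph.sym G-e) (λ f → indicator f g 1ℚ) (λ x y → indicator-flip x y g 1ℚ) (src≈e q) _)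
          (cong (λ L → mult L g) (edges-avoid (path (src q)) _))

  route-above : ∀ q → All (Above (rk e)) (edges (route q))
  route-above q =
    All-reorient (Graph.sym G-e) (above-unoriented (rk e)) (src≈e q) _
      (subst (All (Above (rk e))) (sym (edges-avoid (path (src q)) _))
             (subst (λ r → All (Above r) (edges (path (src q)))) (rk-resp (src≈e q)) (src-ranked q)))

  module _ (d : Detour G) (d≉e : ¬ SameEdge (dEdge d) e) (d-ranked : Ranked d) (q : Supply) where

    private
      erased : Σ (Walk (Adj G-e) (v d) (u d))
                 (λ R → IsPath R × edges R ⊆ edges (splice (route q) (path d)))
      erased = loopErase (splice (route q) (path d))

    reroutedPath : Walk (Adj G-e) (v d) (u d)
    reroutedPath = proj₁ erased

    -- d precedes e (as d charges e) and e precedes every edge of the route,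
    -- so d still precedes every edge of the new path.
    reroutedPath-ranked : All (Above (rk (dEdge d))) (edges reroutedPath)
    reroutedPath-ranked =
      SubP.All-resp-⊆ (proj₂ (proj₂ erased))
        (All-splice (route q) (above-unoriented _)
          (λ d<e → All.map (ℕP.<-trans d<e) (route-above q)) (path d) d-ranked)

    rerouted : Detour G-e
    rerouted = detour (u d) (v d) (adj d , d≉e) reroutedPath
                      (proj₁ (proj₂ erased) , above-∉ reroutedPath-ranked)

    mult-rerouted : ∀ g → ¬ SameEdge g e →
      mult (edges reroutedPath) g ≤ mult (edges (path d)) g + mult (edges (path d)) e * usage q g
    mult-rerouted g g≉e = begin
      mult (edges reroutedPath) g
        ≤⟨ mult-⊆ g (proj₂ (proj₂ erased)) ⟩
      mult (edges (splice (route q) (path d))) g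
        ≤⟨ mult-splice (route q) g g≉e (path d) ⟩
      mult (edges (path d)) g + mult (edges (path d)) e * mult (edges (route q)) g
        ≡⟨ cong (λ m → mult (edges (path d)) g + mult (edges (path d)) e * m) (mult-route q g) ⟩
      mult (edges (path d)) g + mult (edges (path d)) e * usage q g ∎
      where open ℚP.≤-Reasoning

  data Role (d : Detour G) (x : ℚ) : Set where
    of-e       : SameEdge (dEdge d) e → 0ℚ < x → Ranked d → Role d x
    reroutable : ¬ SameEdge (dEdge d) e → 0ℚ < x → Ranked d → Role d x
    idle       : ¬ (0ℚ < x × Ranked d) → Role d x

  role : ∀ d x → Role d x
  role d x with 0ℚ ℚP.<? x | ranked? d
  ... | no x≯0  | _     = idle (x≯0 ∘ proj₁)
  ... | yes _   | no ¬r = idle (¬r ∘ proj₂)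
  ... | yes x>0 | yes r with sameEdge? (dEdge d) e
  ...   | yes d≈e = of-e d≈e x>0 r
  ...   | no d≉e  = reroutable d≉e x>0 r

  -- What an acyclic charging scheme guarantees about each of its entries.
  Admissible : Detour G × ℚ → Set
  Admissible (d , x) = 0ℚ ≤ x × (0ℚ < x → Ranked d)

  idle-weight : ∀ {d x} → Admissible (d , x) → ¬ (0ℚ < x × Ranked d) → x ≡ 0ℚ
  idle-weight (x≥0 , ranked) not-active =
    ℚP.≤-antisym (ℚP.≮⇒≥ (λ x>0 → not-active (x>0 , ranked x>0))) x≥0

  supplies : Detour G × ℚ → List Supply
  supplies (d , x) with role d x
  ... | of-e d≈e x>0 r = record { src = d ; weight = x ; src≈e = d≈e ; weight>0 = x>0 ; src-ranked = r } ∷ []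
  ... | reroutable _ _ _ = []
  ... | idle _ = []

  load : ∀ {H : Graph n} → Detour H × ℚ → Edge n → ℚ
  load dx g = sumℚ (map (λ f → indicator f g (proj₂ dx)) (edges (path (proj₁ dx))))

  load-nonneg : ∀ {H : Graph n} (dx : Detour H × ℚ) g → 0ℚ ≤ proj₂ dx → 0ℚ ≤ load dx g
  load-nonneg dx g x≥0 = sum-nonneg (All.universal (λ f → indicator-nonneg f g x≥0) (edges (path (proj₁ dx))))

  delivered : List Supply → Edge n → ℚ
  delivered qs g = sumℚ (map (λ q → weight q * usage q g) qs)

  weight-supplies : ∀ d x → Admissible (d , x) →
                    sumℚ (map weight (supplies (d , x))) ≡ indicator (dEdge d) e x
  weight-supplies d x adm with role d x
  ... | of-e d≈e _ _      = trans (ℚP.+-identityʳ x) (sym (indicator-same x d≈e))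
  ... | reroutable d≉e _ _ = sym (indicator-apart x d≉e)
  ... | idle not-active   rewrite idle-weight {d} adm not-active = sym (indicator-zero (dEdge d) e)

  module Reroute (S : Scheme G) (adm : All Admissible S) (O>0 : 0ℚ < Out S e) where

    O : ℚ
    O = Out S e

    Sup : List Supply
    Sup = concatMap supplies S

    weight-Sup : sumℚ (map weight Sup) ≡ O
    weight-Sup = trans (sum-concatMap weight supplies S)
                       (cong sumℚ (map-cong-local (All.map (λ {dx} → weight-supplies (proj₁ dx) (proj₂ dx)) adm)))

    1/O : ℚ
    1/O = ℚ.1/_ O {{ℚ.>-nonZero O>0}}

    1/O-nonneg : 0ℚ ≤ 1/O
    1/O-nonneg = ℚP.<⇒≤ (ℚP.positive⁻¹ 1/O {{ℚP.1/pos⇒pos O {{ℚ.positive O>0}}}})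

    share : Supply → ℚ
    share q = weight q * 1/O

    share-nonneg : ∀ q → 0ℚ ≤ share q
    share-nonneg q = *-nonneg (ℚP.<⇒≤ (weight>0 q)) 1/O-nonneg

    shares-sum : sumℚ (map share Sup) ≡ 1ℚ
    shares-sum = begin
      sumℚ (map share Sup)         ≡⟨ sum-scaleʳ 1/O weight Sup ⟩
      sumℚ (map weight Sup) * 1/O  ≡⟨ cong (_* 1/O) weight-Sup ⟩
      O * 1/O                      ≡⟨ ℚP.*-inverseʳ O {{ℚ.>-nonZero O>0}} ⟩
      1ℚ                           ∎
      where open ≡-Reasoning

    -- K g: the average number of times a route, chosen according to the
    -- shares, uses g; O · K g is the charge e sends to g.
    K : Edge n → ℚ
    K g = sumℚ (map (λ q → share q * usage q g) Sup)

    K-nonneg : ∀ g → 0ℚ ≤ K g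
    K-nonneg g = sum-nonneg (All.universal (λ q → *-nonneg (share-nonneg q) (mult-nonneg (edges (path (src q))) g)) Sup)

    O*K : ∀ g → O * K g ≡ delivered Sup g
    O*K g = begin
      O * K g                                         ≡⟨ sym (sum-scaleˡ O _ Sup) ⟩
      sumℚ (map (λ q → O * (share q * usage q g)) Sup) ≡⟨ cong sumℚ (map-cong per-supply Sup) ⟩
      delivered Sup g                                 ∎
      where
        open ≡-Reasoning
        per-supply : ∀ q → O * (share q * usage q g) ≡ weight q * usage q g
        per-supply q = begin
          O * ((weight q * 1/O) * usage q g)  ≡⟨ solve 4 (λ o w i u → o :* ((w :* i) :* u) := (w :* u) :* (o :* i))
                                                   refl O (weight q) 1/O (usage q g) ⟩
          (weight q * usage q g) * (O * 1/O) ≡⟨ cong ((weight q * usage q g) *_) (ℚP.*-inverseʳ O {{ℚ.>-nonZero O>0}}) ⟩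
          (weight q * usage q g) * 1ℚ         ≡⟨ ℚP.*-identityʳ _ ⟩
          weight q * usage q g                ∎

    block : Detour G × ℚ → Scheme G-e
    block (d , x) with role d x
    ... | reroutable d≉e _ r = map (λ q → rerouted d d≉e r q , x * share q) Sup
    ... | of-e _ _ _ = []
    ... | idle _     = []

    S′ : Scheme G-e
    S′ = concatMap block S

    block-nonneg : ∀ dx → Admissible dx → All (λ dy → 0ℚ ≤ proj₂ dy) (block dx)
    block-nonneg (d , x) (x≥0 , _) with role d x
    ... | reroutable _ _ _ = AllP.map⁺ (All.universal (λ q → *-nonneg x≥0 (share-nonneg q)) Sup)
    ... | of-e _ _ _ = []
    ... | idle _     = []

    block-chargers : ∀ (P : Fin n → Fin n → Set) dx →
      (0ℚ < proj₂ dx → P (u (proj₁ dx)) (v (proj₁ dx))) →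
      All (λ dy → 0ℚ < proj₂ dy → P (u (proj₁ dy)) (v (proj₁ dy))) (block dx)
    block-chargers P (d , x) charger with role d x
    ... | reroutable _ x>0 _ = AllP.map⁺ (All.universal (λ _ _ → charger x>0) Sup)
    ... | of-e _ _ _ = []
    ... | idle _     = []

    block-ranked : ∀ dx → All (λ dy → 0ℚ < proj₂ dy → Ranked (proj₁ dy)) (block dx)
    block-ranked (d , x) with role d x
    ... | reroutable d≉e _ r = AllP.map⁺ (All.universal (λ q _ → reroutedPath-ranked d d≉e r q) Sup)
    ... | of-e _ _ _ = []
    ... | idle _     = []

    block-Out : ∀ d x → Admissible (d , x) → ∀ g → ¬ SameEdge g e →
                Out (block (d , x)) g ≡ indicator (dEdge d) g x
    block-Out d x adm g g≉e with role d x
    ... | of-e d≈e _ _ = sym (indicator-apart x (λ d≈g → g≉e (sameEdge-trans (sameEdge-sym d≈g) d≈e)))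
    ... | idle not-active rewrite idle-weight {d} adm not-active = sym (indicator-zero (dEdge d) g)
    ... | reroutable d≉e _ r = begin
      Out (map (λ q → rerouted d d≉e r q , x * share q) Sup) g
        ≡⟨ sum-map (λ dy → indicator (dEdge (proj₁ dy)) g (proj₂ dy)) _ Sup ⟩
      sumℚ (map (λ q → indicator (dEdge d) g (x * share q)) Sup)
        ≡⟨ cong sumℚ (map-cong (λ q → indicator-share q) Sup) ⟩
      sumℚ (map (λ q → indicator (dEdge d) g x * share q) Sup)
        ≡⟨ sum-scaleˡ (indicator (dEdge d) g x) share Sup ⟩
      indicator (dEdge d) g x * sumℚ (map share Sup)
        ≡⟨ cong (indicator (dEdge d) g x *_) shares-sum ⟩
      indicator (dEdge d) g x * 1ℚ
        ≡⟨ ℚP.*-identityʳ _ ⟩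
      indicator (dEdge d) g x ∎
      where
        open ≡-Reasoning
        indicator-share : ∀ q → indicator (dEdge d) g (x * share q) ≡ indicator (dEdge d) g x * share q
        indicator-share q =
          trans (indicator-scale (dEdge d) g _)
                (trans (solve 3 (λ x s i → (x :* s) :* i := (x :* i) :* s) refl x (share q) (indicator (dEdge d) g 1ℚ))
                       (cong (_* share q) (sym (indicator-scale (dEdge d) g x))))

    block-In : ∀ d x → Admissible (d , x) → ∀ g → ¬ SameEdge g e →
      In (block (d , x)) g + delivered (supplies (d , x)) g ≤ load (d , x) g + load (d , x) e * K g
    block-In d x adm@(x≥0 , _) g g≉e with role d x
    ... | of-e _ _ _ = begin
      0ℚ + (x * mP g + 0ℚ)          ≡⟨ solve 1 (λ y → con 0ℚ :+ (y :+ con 0ℚ) := y) refl (x * mP g) ⟩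
      x * mP g                      ≡⟨ sym (charge-mult (edges (path d)) g x) ⟩
      load (d , x) g                ≤⟨ ℚP.≤-trans (ℚP.≤-reflexive (sym (ℚP.+-identityʳ _)))
                                         (ℚP.+-monoʳ-≤ (load (d , x) g) extra≥0) ⟩
      load (d , x) g + load (d , x) e * K g ∎
      where
        open ℚP.≤-Reasoning
        mP : Edge n → ℚ
        mP = mult (edges (path d))
        extra≥0 : 0ℚ ≤ load (d , x) e * K g
        extra≥0 = *-nonneg (load-nonneg (d , x) e x≥0) (K-nonneg g)
    ... | idle not-active = ℚP.≤-trans (ℚP.≤-reflexive (ℚP.+-identityˡ 0ℚ))
                              (ℚP.+-mono-≤ (load-nonneg (d , x) g x≥0)
                                           (*-nonneg (load-nonneg (d , x) e x≥0) (K-nonneg g)))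
    ... | reroutable d≉e _ r = begin
      In (map (λ q → R q , x * share q) Sup) g + 0ℚ
        ≡⟨ trans (ℚP.+-identityʳ _) (sum-map (λ dy → load dy g) _ Sup) ⟩
      sumℚ (map (λ q → load (R q , x * share q) g) Sup)
        ≡⟨ cong sumℚ (map-cong (λ q → charge-mult (edges (path (R q))) g (x * share q)) Sup) ⟩
      sumℚ (map (λ q → (x * share q) * mult (edges (path (R q))) g) Sup)
        ≤⟨ sum-mono (All.universal (λ q → *-monoʳ-nonneg (*-nonneg x≥0 (share-nonneg q))
                                                        (mult-rerouted d d≉e r q g g≉e)) Sup) ⟩
      sumℚ (map (λ q → (x * share q) * (mP g + mP e * usage q g)) Sup)
        ≡⟨ cong sumℚ (map-cong expand Sup) ⟩
      sumℚ (map (λ q → (x * mP g) * share q + (x * mP e) * (share q * usage q g)) Sup)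
        ≡⟨ sum-+ _ _ Sup ⟩
      sumℚ (map (λ q → (x * mP g) * share q) Sup) + sumℚ (map (λ q → (x * mP e) * (share q * usage q g)) Sup)
        ≡⟨ cong₂ _+_ (sum-scaleˡ (x * mP g) share Sup) (sum-scaleˡ (x * mP e) _ Sup) ⟩
      (x * mP g) * sumℚ (map share Sup) + (x * mP e) * K g
        ≡⟨ cong (λ t → (x * mP g) * t + (x * mP e) * K g) shares-sum ⟩
      (x * mP g) * 1ℚ + (x * mP e) * K g
        ≡⟨ cong₂ (λ s t → s + t * K g) (trans (ℚP.*-identityʳ _) (sym (charge-mult (edges (path d)) g x)))
                                      (sym (charge-mult (edges (path d)) e x)) ⟩
      load (d , x) g + load (d , x) e * K g ∎
      where
        open ℚP.≤-Reasoning
        R : Supply → Detour G-e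
        R = rerouted d d≉e r
        mP : Edge n → ℚ
        mP = mult (edges (path d))
        expand : ∀ q → (x * share q) * (mP g + mP e * usage q g)
                       ≡ (x * mP g) * share q + (x * mP e) * (share q * usage q g)
        expand q = solve 5 (λ x s p r u → (x :* s) :* (p :+ r :* u) := (x :* p) :* s :+ (x :* r) :* (s :* u))
                     refl x (share q) (mP g) (mP e) (usage q g)

    S′-nonneg : All (λ dy → 0ℚ ≤ proj₂ dy) S′
    S′-nonneg = AllP.concat⁺ (AllP.map⁺ (All.map (λ {dx} → block-nonneg dx) adm))

    S′-chargers : ∀ (P : Fin n → Fin n → Set) →
      All (λ dx → 0ℚ < proj₂ dx → P (u (proj₁ dx)) (v (proj₁ dx))) S →
      All (λ dy → 0ℚ < proj₂ dy → P (u (proj₁ dy)) (v (proj₁ dy))) S′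
    S′-chargers P chargers = AllP.concat⁺ (AllP.map⁺ (All.map (λ {dx} → block-chargers P dx) chargers))

    S′-ranked : All (λ dy → 0ℚ < proj₂ dy → Ranked (proj₁ dy)) S′
    S′-ranked = AllP.concat⁺ (AllP.map⁺ (All.universal block-ranked S))

    Out-S′ : ∀ g → ¬ SameEdge g e → Out S′ g ≡ Out S g
    Out-S′ g g≉e =
      trans (sum-concatMap (λ dy → indicator (dEdge (proj₁ dy)) g (proj₂ dy)) block S)
            (cong sumℚ (map-cong-local (All.map (λ {dx} a → block-Out (proj₁ dx) (proj₂ dx) a g g≉e) adm)))

    -- Since e receives no more than it sends (In(e) ≤ O), replacing e's
    -- charge on g (which is O · K g) by In(e) · K g does not increase In(g).
    In-S′ : In S e ≤ O → ∀ g → ¬ SameEdge g e → In S′ g ≤ In S g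
    In-S′ In≤O g g≉e = +-cancelʳ-≤ (delivered Sup g) (begin
      In S′ g + delivered Sup g
        ≡⟨ cong₂ _+_ (sum-concatMap (λ dy → load dy g) block S)
                     (sum-concatMap (λ q → weight q * usage q g) supplies S) ⟩
      sumℚ (map (λ dx → In (block dx) g) S) + sumℚ (map (λ dx → delivered (supplies dx) g) S)
        ≡⟨ sym (sum-+ _ _ S) ⟩
      sumℚ (map (λ dx → In (block dx) g + delivered (supplies dx) g) S)
        ≤⟨ sum-mono (All.map (λ {dx} a → block-In (proj₁ dx) (proj₂ dx) a g g≉e) adm) ⟩
      sumℚ (map (λ dx → load dx g + load dx e * K g) S)
        ≡⟨ trans (sum-+ _ _ S) (cong (In S g +_) (sum-scaleʳ (K g) (λ dx → load dx e) S)) ⟩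
      In S g + In S e * K g
        ≤⟨ ℚP.+-monoʳ-≤ (In S g) (ℚP.*-monoʳ-≤-nonNeg (K g) {{ℚ.nonNegative (K-nonneg g)}} In≤O) ⟩
      In S g + O * K g
        ≡⟨ cong (In S g +_) (O*K g) ⟩
      In S g + delivered Sup g ∎)
      where open ℚP.≤-Reasoning

    Net-S′ : In S e ≤ O → ∀ g → ¬ SameEdge g e → Net S′ g ≤ Net S g
    Net-S′ In≤O g g≉e rewrite Out-S′ g g≉e = ℚP.+-monoˡ-≤ (ℚ.- Out S g) (In-S′ In≤O g g≉e)

tree-edge-≉ : ∀ {n} (T : Graph n) {a b x y} → ¬ Adj T a b → Adj T x y → ¬ SameEdge (x , y) (a , b)
tree-edge-≉ T ab∉T xy∈T (inj₁ (refl , refl)) = ab∉T xy∈T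
tree-edge-≉ T ab∉T xy∈T (inj₂ (refl , refl)) = ab∉T (Graph.sym T xy∈T)

spanning-deleteEdge : ∀ {n} (G T : Graph n) {a b} → IsSpanningTree G T → ¬ Adj T a b →
                      IsSpanningTree (deleteEdge G (a , b)) T
spanning-deleteEdge G T (T⊆G , connected , acyclic) ab∉T =
  (λ x y xy∈T → T⊆G x y xy∈T , tree-edge-≉ T ab∉T xy∈T) , connected , acyclic

acyclic-deleteEdge : ∀ {n} (G T : Graph n) val {a b} → Adj G a b → ¬ Adj T a b →
  HasAcyclicChargingScheme G T val → HasAcyclicChargingScheme (deleteEdge G (a , b)) T val
acyclic-deleteEdge G T val {a} {b} ab∈G ab∉T
  (S , (nonneg , Out≥1 , Net≤0 , Net≤val) , chargers , rank , (rank-sym , rank-inj) , ranked) =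
  S′ ,
  ( (S′-nonneg ,
     (λ x y xy∈G-e xy∉T → ℚP.≤-trans (Out≥1 x y (proj₁ xy∈G-e) xy∉T) (ℚP.≤-reflexive (sym (Out-S′ (x , y) (proj₂ xy∈G-e))))) ,
     (λ x y xy∈G-e xy∉T → ℚP.≤-trans (Net-S′ In≤O (x , y) (proj₂ xy∈G-e)) (Net≤0 x y (proj₁ xy∈G-e) xy∉T)) ,
     (λ x y xy∈T → ℚP.≤-trans (Net-S′ In≤O (x , y) (tree-edge-≉ T ab∉T xy∈T)) (Net≤val x y xy∈T))) ,
    S′-chargers (λ x y → ¬ Adj T x y) chargers ,
    rank , (rank-sym , λ p q r s pq rs pq≉rs → rank-inj p q r s (proj₁ pq) (proj₁ rs) pq≉rs) , S′-ranked )
  where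
    open Rerouting G a b rank rank-sym
    O>0 : 0ℚ < Out S e
    O>0 = ℚP.<-≤-trans (ℚP.positive⁻¹ 1ℚ) (Out≥1 a b ab∈G ab∉T)
    open Reroute S (All.zip (nonneg , ranked)) O>0
    In≤O : In S e ≤ O
    In≤O = nonpos-diff (Net≤0 a b ab∈G ab∉T)

lemma1 : ∀ {n} (G T : Graph n) (val : ℚ) → IsSpanningTree G T →
    HasAcyclicChargingScheme G T val →
    ∀ (a b : Fin n) → Adj G a b → ¬ Adj T a b →
    IsSpanningTree (deleteEdge G (a , b)) T ×
    HasAcyclicChargingScheme (deleteEdge G (a , b)) T val
lemma1 G T val tree scheme a b ab∈G ab∉T =
  spanning-deleteEdge G T tree ab∉T , acyclic-deleteEdge G T val ab∈G ab∉T scheme
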